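{- Let $H_{112,121}(x;k)=\sum_{n\ge0}f_{112,121}(n,k)x^n$. Then $H_{112,121}(x;0)=1$ and for every $k\ge1$, \[ H_{112,121}(x;k)=\frac{1}{1-x}H_{112,121}(x;k-1)+x^2\frac{d}{dx}H_{112,121}(x;k-1). \]
   Context: For integers $k,n\ge 0$, a word is an element of $[k]^n$, where $[k]=\{1,\dots,k\}$ is totally ordered. A pattern is a word $\tau\in[\ell]^m$ containing every letter $1,\dots,\ell$. A word $\sigma\in[k]^n$ contains $\tau$ if there are indices $1\le i_1<\dots<i_m\le n$ such that for all $1\le a,b\le m$ and each relation $\phi\in\{<,=,>\}$, $\sigma(i_a)\,\phi\,\sigma(i_b)$ holds iff $\tau(a)\,\phi\,\tau(b)$ holds; otherwise $\sigma$ avoids $\tau$. $f_{112,121}(n,k)$ is the number of words in $[k]^n$ that avoid both $112$ and $121$. Generating functions are formal power series in $x$. -}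

module Defs where

open import Data.Nat using (ℕ; zero; suc; _+_; _*_; _∸_; _≡ᵇ_)
open import Data.Bool using (if_then_else_)
open import Data.Fin using (Fin; toℕ)
open import Data.Fin.Properties using (all?)
open import Data.Vec using (Vec; []; _∷_; lookup)
open import Data.List using (List; []; _∷_; [_]; map; _++_; concatMap; allFin; filter; length)
open import Data.List.Relation.Unary.Any using (Any; any?)
open import Relation.Binary.PropositionalEquality using (_≡_; refl)
open import Relation.Nullary using (Dec; yes; no; ¬_; ¬?)
open import Relation.Nullary.Decidable using (_×-dec_)
open import Data.Product using (_×_)

data Rel3 : Set where
  lt eq gt : Rel3

_≟R_ : (a b : Rel3) → Dec (a ≡ b)
lt ≟R lt = yes refl
lt ≟R eq = no λ ()
lt ≟R gt = no λ ()
eq ≟R lt = no λ ()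
eq ≟R eq = yes refl
eq ≟R gt = no λ ()
gt ≟R lt = no λ ()
gt ≟R eq = no λ ()
gt ≟R gt = yes refl

cmpℕ : ℕ → ℕ → Rel3
cmpℕ zero    zero    = eq
cmpℕ zero    (suc _) = lt
cmpℕ (suc _) zero    = gt
cmpℕ (suc m) (suc n) = cmpℕ m n

cmp : ∀ {k} → Fin k → Fin k → Rel3
cmp a b = cmpℕ (toℕ a) (toℕ b)

-- A word in [k]^n; the letter i ∈ [k] is represented by i-1 : Fin k
-- (an order-isomorphic relabelling).
Word : ℕ → ℕ → Set
Word k n = Vec (Fin k) n

subseqs : ∀ {A : Set} {n} (m : ℕ) → Vec A n → List (Vec A m)
subseqs zero    _        = [ [] ]
subseqs (suc m) []       = []
subseqs (suc m) (x ∷ xs) = map (x ∷_) (subseqs m xs) ++ subseqs (suc m) xs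

OrderIso : ∀ {k l m} → Vec (Fin k) m → Vec (Fin l) m → Set
OrderIso {m = m} s t = ∀ (a b : Fin m) → cmp (lookup s a) (lookup s b) ≡ cmp (lookup t a) (lookup t b)

orderIso? : ∀ {k l m} (s : Vec (Fin k) m) (t : Vec (Fin l) m) → Dec (OrderIso s t)
orderIso? s t = all? λ a → all? λ b → cmp (lookup s a) (lookup s b) ≟R cmp (lookup t a) (lookup t b)

Contains : ∀ {k n l m} → Word k n → Vec (Fin l) m → Set
Contains {m = m} σ τ = Any (λ s → OrderIso s τ) (subseqs m σ)

contains? : ∀ {k n l m} (σ : Word k n) (τ : Vec (Fin l) m) → Dec (Contains σ τ)
contains? {m = m} σ τ = any? (λ s → orderIso? s τ) (subseqs m σ)

Avoids : ∀ {k n l m} → Word k n → Vec (Fin l) m → Set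
Avoids σ τ = ¬ Contains σ τ

p112 : Vec (Fin 2) 3
p112 = Fin.zero ∷ Fin.zero ∷ Fin.suc Fin.zero ∷ []

p121 : Vec (Fin 2) 3
p121 = Fin.zero ∷ Fin.suc Fin.zero ∷ Fin.zero ∷ []

allWords : (k n : ℕ) → List (Word k n)
allWords k zero    = [ [] ]
allWords k (suc n) = concatMap (λ a → map (a ∷_) (allWords k n)) (allFin k)

avoidsBoth? : ∀ {k n} (σ : Word k n) → Dec (Avoids σ p112 × Avoids σ p121)
avoidsBoth? σ = (¬? (contains? σ p112)) ×-dec (¬? (contains? σ p121))

f112-121 : ℕ → ℕ → ℕ
f112-121 n k = length (filter avoidsBoth? (allWords k n))

-- Formal power series in x with ℕ coefficients: coefficient sequences.

FPS : Set
FPS = ℕ → ℕ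

_≈_ : FPS → FPS → Set
F ≈ G = ∀ n → F n ≡ G n

one : FPS
one zero    = 1
one (suc _) = 0

_⊕_ : FPS → FPS → FPS
(F ⊕ G) n = F n + G n

-- Cauchy product: (F ⊗ G)_n = Σ_{i=0}^{n} F_i G_{n-i}
convSum : FPS → FPS → ℕ → ℕ → ℕ
convSum F G n zero    = F 0 * G n
convSum F G n (suc i) = F (suc i) * G (n ∸ suc i) + convSum F G n i

_⊗_ : FPS → FPS → FPS
(F ⊗ G) n = convSum F G n n

-- 1/(1-x) = Σ_n x^n
geom : FPS
geom _ = 1

x² : FPS
x² n = if n ≡ᵇ 2 then 1 else 0

deriv : FPS → FPS
deriv F n = suc n * F (suc n)

H : ℕ → FPS
H k n = f112-121 n k

-- A word contains 112 or 121 exactly when some letter recurs later together with a later,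
-- larger letter. Split the avoiding words over [k+1] by the occurrences of the smallest letter:
-- without it they are the avoiding words over the other k letters, f(n,k) of them; a single
-- occurrence can sit at any of the n positions and never takes part in a pattern, giving
-- n f(n-1,k); with two or more occurrences nothing larger may follow the first one, so the word is
-- an avoiding word over the other letters followed by a run of at least two smallest letters,
-- giving f(i,k) for each i ≤ n-2. Thus f(n,k+1) = f(n,k) + n f(n-1,k) + Σ_{i ≤ n-2} f(i,k),
-- which is the functional equation read off coefficientwise.

module Submission where

open import Defs
open import Data.Bool.Base using (Bool; true; false; T; not; _∧_; _∨_; if_then_else_)
open import Data.Bool.ListAction using (any; or)
open import Data.Bool.Properties using (T-≡; T-∨; T-∧; ∧-zeroʳ; ∨-zeroʳ)
open import Data.Empty using (⊥; ⊥-elim)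
open import Data.Fin.Base using (Fin; toℕ)
import Data.Fin.Base as Fin
open import Data.Fin.Patterns using (0F; 1F; 2F)
open import Data.Fin.Properties using (toℕ-injective; toℕ-inject₁; toℕ-fromℕ)
open import Data.List.Base
  using (List; []; _∷_; [_]; map; replicate; _++_; concatMap; tabulate; filter; length)
open import Data.List.Properties using (map-id; map-∘; map-++; ++-assoc; ++-identityʳ)
open import Data.List.Relation.Unary.Any using (Any; here; there)
open import Data.List.Relation.Unary.Any.Properties using (map⁺; map⁻; ++⁺ˡ; ++⁺ʳ; ++⁻; Any-⊎⁻)
open import Data.Nat.Base using (ℕ; zero; suc; pred; _+_; _*_; _∸_; _<_; _≡ᵇ_; _<ᵇ_; s≤s; z<s)
open import Data.Nat.Properties
  using (≡ᵇ⇒≡; ≡⇒≡ᵇ; <ᵇ⇒<; <⇒<ᵇ; <-irrefl; +-suc; +-identityʳ; m+n∸m≡n; +-*-semiring)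
open import Data.Nat.Solver using (module +-*-Solver)
open import Algebra.Properties.Semiring.Sum +-*-semiring
  using (sum-syntax; sum-cong-≗; sum-replicate-zero; sum-init-last; ∑-comm; *-distribˡ-sum)
open import Data.Product using (_×_; _,_; ∃; ∃₂)
open import Data.Sum using (_⊎_; inj₁; inj₂)
import Data.Sum as Sum
open import Data.Vec.Base using (Vec; []; _∷_; toList)
import Data.Vec.Base as Vec
open import Data.Vec.Membership.Propositional using (_∈_)
import Data.Vec.Relation.Unary.Any as VecAny
open import Function.Base using (_∘_)
open import Function.Bundles using (_⇔_; mk⇔; Equivalence)
open import Relation.Binary.PropositionalEquality
  using (_≡_; refl; cong; cong₂; sym; trans; subst; module ≡-Reasoning)
open import Relation.Nullary using (¬_; yes; no)
open import Relation.Nullary.Negation using (_¬-⊎_)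
open import Relation.Unary using (Decidable)

open Equivalence using (to; from)
open ≡-Reasoning

-- Avoiding 112 and 121

letters : ∀ {k n} → Word k n → List ℕ
letters = toList ∘ Vec.map toℕ

recursWithLarger : ℕ → List ℕ → Bool
recursWithLarger x w = any (x ≡ᵇ_) w ∧ any (x <ᵇ_) w

bad : List ℕ → Bool
bad []      = false
bad (x ∷ w) = recursWithLarger x w ∨ bad w

cmpℕ-refl : ∀ m → cmpℕ m m ≡ eq
cmpℕ-refl zero    = refl
cmpℕ-refl (suc m) = cmpℕ-refl m

cmpℕ-< : ∀ {m n} → m < n → cmpℕ m n ≡ lt
cmpℕ-< z<s                = refl
cmpℕ-< {suc _} (s≤s m<n) = cmpℕ-< m<n

cmpℕ-> : ∀ {m n} → m < n → cmpℕ n m ≡ gt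
cmpℕ-> z<s                = refl
cmpℕ-> {suc _} (s≤s m<n) = cmpℕ-> m<n

cmpℕ≡eq⇒≡ : ∀ m n → cmpℕ m n ≡ eq → m ≡ n
cmpℕ≡eq⇒≡ zero    zero    _ = refl
cmpℕ≡eq⇒≡ (suc m) (suc n) e = cong suc (cmpℕ≡eq⇒≡ m n e)

cmpℕ≡lt⇒< : ∀ m n → cmpℕ m n ≡ lt → m < n
cmpℕ≡lt⇒< zero    (suc n) _ = z<s
cmpℕ≡lt⇒< (suc m) (suc n) e = s≤s (cmpℕ≡lt⇒< m n e)

module _ {k} {x : Fin k} where

  iso₁₁₂ : ∀ {a b} → toℕ x ≡ toℕ a → toℕ x < toℕ b → OrderIso (x ∷ a ∷ b ∷ []) p112
  iso₁₁₂ {b = b} x≡a x<b with refl ← toℕ-injective x≡a = λ where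
    0F 0F → cmpℕ-refl (toℕ x)
    0F 1F → cmpℕ-refl (toℕ x)
    0F 2F → cmpℕ-< x<b
    1F 0F → cmpℕ-refl (toℕ x)
    1F 1F → cmpℕ-refl (toℕ x)
    1F 2F → cmpℕ-< x<b
    2F 0F → cmpℕ-> x<b
    2F 1F → cmpℕ-> x<b
    2F 2F → cmpℕ-refl (toℕ b)

  iso₁₂₁ : ∀ {a b} → toℕ x < toℕ a → toℕ x ≡ toℕ b → OrderIso (x ∷ a ∷ b ∷ []) p121
  iso₁₂₁ {a} x<a x≡b with refl ← toℕ-injective x≡b = λ where
    0F 0F → cmpℕ-refl (toℕ x)
    0F 1F → cmpℕ-< x<a
    0F 2F → cmpℕ-refl (toℕ x)
    1F 0F → cmpℕ-> x<a
    1F 1F → cmpℕ-refl (toℕ a)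
    1F 2F → cmpℕ-> x<a
    2F 0F → cmpℕ-refl (toℕ x)
    2F 1F → cmpℕ-< x<a
    2F 2F → cmpℕ-refl (toℕ x)

  iso₁₁₂⁻ : ∀ {a b} → OrderIso (x ∷ a ∷ b ∷ []) p112 → toℕ x ≡ toℕ a × toℕ x < toℕ b
  iso₁₁₂⁻ iso = cmpℕ≡eq⇒≡ _ _ (iso 0F 1F) , cmpℕ≡lt⇒< _ _ (iso 0F 2F)

  iso₁₂₁⁻ : ∀ {a b} → OrderIso (x ∷ a ∷ b ∷ []) p121 → toℕ x < toℕ a × toℕ x ≡ toℕ b
  iso₁₂₁⁻ iso = cmpℕ≡lt⇒< _ _ (iso 0F 1F) , cmpℕ≡eq⇒≡ _ _ (iso 0F 2F)

subseqs₁⁻ : ∀ {A : Set} {n} {P : Vec A 1 → Set} (σ : Vec A n) →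
            Any P (subseqs 1 σ) → ∃ λ b → b ∈ σ × P (b ∷ [])
subseqs₁⁻ (c ∷ σ) (here p)  = c , VecAny.here refl , p
subseqs₁⁻ (c ∷ σ) (there q) = let b , b∈σ , p = subseqs₁⁻ σ q in b , VecAny.there b∈σ , p

subseqs₂⁻ : ∀ {A : Set} {n} {P : Vec A 2 → Set} (σ : Vec A n) →
            Any P (subseqs 2 σ) → ∃₂ λ a b → a ∈ σ × b ∈ σ × P (a ∷ b ∷ [])
subseqs₂⁻ (c ∷ σ) q with ++⁻ (map (c ∷_) (subseqs 1 σ)) q
... | inj₁ q₁ = let b , b∈σ , p = subseqs₁⁻ σ (map⁻ q₁)
              in c , b , VecAny.here refl , VecAny.there b∈σ , p
... | inj₂ q₂ = let a , b , a∈σ , b∈σ , p = subseqs₂⁻ σ q₂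
              in a , b , VecAny.there a∈σ , VecAny.there b∈σ , p

∈⇒any : ∀ (p : ℕ → Bool) {k n a} {σ : Word k n} → a ∈ σ → T (p (toℕ a)) → T (any p (letters σ))
∈⇒any p (VecAny.here refl)  pa = from T-∨ (inj₁ pa)
∈⇒any p (VecAny.there a∈σ) pa = from T-∨ (inj₂ (∈⇒any p a∈σ pa))

subseqs₁⁺ : ∀ {k n} {P : Vec (Fin k) 1 → Set} (B : ℕ → Bool) (σ : Word k n) →
            (∀ {b} → T (B (toℕ b)) → P (b ∷ [])) → T (any B (letters σ)) → Any P (subseqs 1 σ)
subseqs₁⁺ B (c ∷ σ) f h with to T-∨ h
... | inj₁ hc = here (f hc)
... | inj₂ hσ = there (subseqs₁⁺ B σ f hσ)

subseqs₂⁺ : ∀ {k n} {P : Vec (Fin k) 2 → Set} (A B : ℕ → Bool) (σ : Word k n) →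
            (∀ c → T (A c) → T (B c) → ⊥) →
            (∀ {a b} → T (A (toℕ a)) → T (B (toℕ b)) → P (a ∷ b ∷ [])) →
            (∀ {a b} → T (B (toℕ a)) → T (A (toℕ b)) → P (a ∷ b ∷ [])) →
            T (any A (letters σ)) → T (any B (letters σ)) → Any P (subseqs 2 σ)
subseqs₂⁺ A B (c ∷ σ) disjoint f g hA hB with to T-∨ hA | to T-∨ hB
... | inj₁ hAc | inj₁ hBc = ⊥-elim (disjoint _ hAc hBc)
... | inj₁ hAc | inj₂ hBσ = ++⁺ˡ (map⁺ (subseqs₁⁺ B σ (f hAc) hBσ))
... | inj₂ hAσ | inj₁ hBc = ++⁺ˡ (map⁺ (subseqs₁⁺ A σ (g hBc) hAσ))
... | inj₂ hAσ | inj₂ hBσ = ++⁺ʳ _ (subseqs₂⁺ A B σ disjoint f g hAσ hBσ)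

module _ {k n} (x : Fin k) (σ : Word k n) where

  StartsPattern : ∀ {l} → Vec (Fin l) 3 → Set
  StartsPattern τ = Any (λ s → OrderIso (x ∷ s) τ) (subseqs 2 σ)

  startsPattern⇒recursWithLarger : StartsPattern p112 ⊎ StartsPattern p121 →
                                   T (recursWithLarger (toℕ x) (letters σ))
  startsPattern⇒recursWithLarger (inj₁ s) =
    let a , b , a∈σ , b∈σ , iso = subseqs₂⁻ σ s
        x≡a , x<b = iso₁₁₂⁻ iso
    in from T-∧ (∈⇒any _ a∈σ (≡⇒≡ᵇ _ _ x≡a) , ∈⇒any _ b∈σ (<⇒<ᵇ x<b))
  startsPattern⇒recursWithLarger (inj₂ s) =
    let a , b , a∈σ , b∈σ , iso = subseqs₂⁻ σ s
        x<a , x≡b = iso₁₂₁⁻ iso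
    in from T-∧ (∈⇒any _ b∈σ (≡⇒≡ᵇ _ _ x≡b) , ∈⇒any _ a∈σ (<⇒<ᵇ x<a))

  recursWithLarger⇒startsPattern : T (recursWithLarger (toℕ x) (letters σ)) →
                                   StartsPattern p112 ⊎ StartsPattern p121
  recursWithLarger⇒startsPattern h =
    let same , larger = to T-∧ h
    in Any-⊎⁻ (subseqs₂⁺ (toℕ x ≡ᵇ_) (toℕ x <ᵇ_) σ disjoint
                 (λ x≡a x<b → inj₁ (iso₁₁₂ (≡ᵇ⇒≡ _ _ x≡a) (<ᵇ⇒< _ _ x<b)))
                 (λ x<a x≡b → inj₂ (iso₁₂₁ (<ᵇ⇒< _ _ x<a) (≡ᵇ⇒≡ _ _ x≡b)))
                 same larger)
    where
    disjoint : ∀ c → T (toℕ x ≡ᵇ c) → T (toℕ x <ᵇ c) → ⊥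
    disjoint c x≡c x<c = <-irrefl (≡ᵇ⇒≡ (toℕ x) c x≡c) (<ᵇ⇒< (toℕ x) c x<c)

Contains112∨121 : ∀ {k n} → Word k n → Set
Contains112∨121 σ = Contains σ p112 ⊎ Contains σ p121

contains-∷⁻ : ∀ {k n l m} {τ : Vec (Fin l) (suc m)} (x : Fin k) (σ : Word k n) →
              Contains (x ∷ σ) τ → Any (λ s → OrderIso (x ∷ s) τ) (subseqs m σ) ⊎ Contains σ τ
contains-∷⁻ x σ c = Sum.map₁ map⁻ (++⁻ (map (x ∷_) (subseqs _ σ)) c)

contains⇒bad : ∀ {k n} (σ : Word k n) → Contains112∨121 σ → T (bad (letters σ))
contains⇒bad [] (inj₁ ())
contains⇒bad [] (inj₂ ())
contains⇒bad (x ∷ σ) c = from T-∨ (split c)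
  where
  split : Contains112∨121 (x ∷ σ) → T (recursWithLarger (toℕ x) (letters σ)) ⊎ T (bad (letters σ))
  split (inj₁ c) = Sum.map (startsPattern⇒recursWithLarger x σ ∘ inj₁) (contains⇒bad σ ∘ inj₁)
                           (contains-∷⁻ {τ = p112} x σ c)
  split (inj₂ c) = Sum.map (startsPattern⇒recursWithLarger x σ ∘ inj₂) (contains⇒bad σ ∘ inj₂)
                           (contains-∷⁻ {τ = p121} x σ c)

bad⇒contains : ∀ {k n} (σ : Word k n) → T (bad (letters σ)) → Contains112∨121 σ
bad⇒contains (x ∷ σ) h with to T-∨ h
... | inj₁ r = Sum.map (++⁺ˡ ∘ map⁺) (++⁺ˡ ∘ map⁺) (recursWithLarger⇒startsPattern x σ r)
... | inj₂ b = Sum.map (++⁺ʳ _) (++⁺ʳ _) (bad⇒contains σ b)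

¬T⇔T-not : ∀ {b} → (¬ T b) ⇔ T (not b)
¬T⇔T-not {true}  = mk⇔ (λ ¬t → ¬t _) (λ ())
¬T⇔T-not {false} = mk⇔ (λ _ → _) (λ _ ())

avoidsBoth⇔notBad : ∀ {k n} (σ : Word k n) →
                    (Avoids σ p112 × Avoids σ p121) ⇔ T (not (bad (letters σ)))
avoidsBoth⇔notBad σ = mk⇔
  (λ (¬c₁₁₂ , ¬c₁₂₁) → to ¬T⇔T-not ((¬c₁₁₂ ¬-⊎ ¬c₁₂₁) ∘ bad⇒contains σ))
  (λ h → let ¬bad = from ¬T⇔T-not h in ¬bad ∘ contains⇒bad σ ∘ inj₁ , ¬bad ∘ contains⇒bad σ ∘ inj₂)

-- Counting words

count : ∀ {A : Set} → (A → Bool) → List A → ℕ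
count p []       = 0
count p (x ∷ xs) = if p x then suc (count p xs) else count p xs

module _ {A : Set} where

  length-filter≡count : ∀ {P : A → Set} (P? : Decidable P) (p : A → Bool) →
                        (∀ x → P x ⇔ T (p x)) → ∀ xs → length (filter P? xs) ≡ count p xs
  length-filter≡count P? p P⇔p []       = refl
  length-filter≡count P? p P⇔p (x ∷ xs) with P? x | p x in px
  ... | yes Px | true  = cong suc (length-filter≡count P? p P⇔p xs)
  ... | yes Px | false = ⊥-elim (subst T px (to (P⇔p x) Px))
  ... | no ¬Px | true  = ⊥-elim (¬Px (from (P⇔p x) (subst T (sym px) _)))
  ... | no ¬Px | false = length-filter≡count P? p P⇔p xs

  count-++ : ∀ (p : A → Bool) xs ys → count p (xs ++ ys) ≡ count p xs + count p ys
  count-++ p []       ys = refl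
  count-++ p (x ∷ xs) ys with p x
  ... | true  = cong suc (count-++ p xs ys)
  ... | false = count-++ p xs ys

  count-map : ∀ {B : Set} (p : B → Bool) (f : A → B) xs → count p (map f xs) ≡ count (p ∘ f) xs
  count-map p f []       = refl
  count-map p f (x ∷ xs) with p (f x)
  ... | true  = cong suc (count-map p f xs)
  ... | false = count-map p f xs

  count-cong : ∀ {p q : A → Bool} → (∀ x → p x ≡ q x) → ∀ xs → count p xs ≡ count q xs
  count-cong p≗q []       = refl
  count-cong p≗q (x ∷ xs) = cong₂ (λ b c → if b then suc c else c) (p≗q x) (count-cong p≗q xs)

  count-false : ∀ xs → count (λ (_ : A) → false) xs ≡ 0
  count-false []       = refl
  count-false (x ∷ xs) = count-false xs

  count-∧-split : ∀ (c p : A → Bool) xs →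
                  count p xs ≡ count (λ x → c x ∧ p x) xs + count (λ x → not (c x) ∧ p x) xs
  count-∧-split c p []       = refl
  count-∧-split c p (x ∷ xs) with c x | p x
  ... | true  | true  = cong suc (count-∧-split c p xs)
  ... | true  | false = count-∧-split c p xs
  ... | false | true  = trans (cong suc (count-∧-split c p xs)) (sym (+-suc _ _))
  ... | false | false = count-∧-split c p xs

  count-concatMap-tabulate : ∀ {B : Set} (p : A → Bool) {k} (h : Fin k → B) (f : B → List A) →
                             count p (concatMap f (tabulate h)) ≡ ∑[ i < k ] count p (f (h i))
  count-concatMap-tabulate p {zero}  h f = refl
  count-concatMap-tabulate p {suc k} h f =
    trans (count-++ p (f (h 0F)) _)
          (cong (count p (f (h 0F)) +_) (count-concatMap-tabulate p (h ∘ Fin.suc) f))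

countWords : ℕ → ℕ → (List ℕ → Bool) → ℕ
countWords k n p = count (p ∘ letters) (allWords k n)

avoiders : ℕ → ℕ → ℕ
avoiders k n = countWords k n (not ∘ bad)

H≡avoiders : ∀ k n → H k n ≡ avoiders k n
H≡avoiders k n = length-filter≡count avoidsBoth? _ avoidsBoth⇔notBad (allWords k n)

module _ (k : ℕ) where

  countWords-suc : ∀ n p → countWords k (suc n) p ≡ ∑[ a < k ] countWords k n (λ w → p (toℕ a ∷ w))
  countWords-suc n p =
    trans (count-concatMap-tabulate (p ∘ letters) (λ a → a) (λ a → map (a ∷_) (allWords k n)))
          (sum-cong-≗ λ a → count-map (p ∘ letters) (a ∷_) (allWords k n))

  countWords-cong : ∀ n {p q} → (∀ w → p w ≡ q w) → countWords k n p ≡ countWords k n q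
  countWords-cong n p≗q = count-cong (p≗q ∘ letters) (allWords k n)

  countWords-split : ∀ n (c p : List ℕ → Bool) →
                     countWords k n p ≡ countWords k n (λ w → c w ∧ p w) + countWords k n (λ w → not (c w) ∧ p w)
  countWords-split n c p = count-∧-split (c ∘ letters) (p ∘ letters) (allWords k n)

  ∑-countWords-false : ∀ m n → ∑[ a < k ] countWords m n (λ _ → false) ≡ 0
  ∑-countWords-false m n = trans (sum-cong-≗ {k} λ _ → count-false (allWords m n)) (sum-replicate-zero k)

-- The smallest letter

zeroFree : List ℕ → Bool
zeroFree []          = true
zeroFree (zero ∷ _)  = false
zeroFree (suc _ ∷ w) = zeroFree w

oneZero : List ℕ → Bool
oneZero []          = false
oneZero (zero ∷ w)  = zeroFree w
oneZero (suc _ ∷ w) = oneZero w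

allZero : List ℕ → Bool
allZero []          = true
allZero (zero ∷ w)  = allZero w
allZero (suc _ ∷ _) = false

-- On a word with exactly one 0, deletes it and lowers every other letter by one.
dropZero : List ℕ → List ℕ
dropZero []          = []
dropZero (zero ∷ w)  = map pred w
dropZero (suc x ∷ w) = x ∷ dropZero w

-- zeroTail q w holds iff w = map suc u ++ 0 ∷ 0 ∷ … ∷ 0 (at least two 0s) and q u.
zeroTail : (List ℕ → Bool) → List ℕ → Bool
zeroTail q []          = false
zeroTail q (zero ∷ w)  = allZero w ∧ (not (zeroFree w) ∧ q [])
zeroTail q (suc y ∷ w) = zeroTail (λ v → q (y ∷ v)) w

zeroTail-cong : ∀ {q q′ : List ℕ → Bool} → (∀ v → q v ≡ q′ v) →
                ∀ w → zeroTail q w ≡ zeroTail q′ w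
zeroTail-cong q≗q′ []          = refl
zeroTail-cong q≗q′ (zero ∷ w)  = cong (λ b → allZero w ∧ (not (zeroFree w) ∧ b)) (q≗q′ [])
zeroTail-cong q≗q′ (suc y ∷ w) = zeroTail-cong (q≗q′ ∘ (y ∷_)) w

oneZero⇒¬zeroFree : ∀ w → T (oneZero w) → zeroFree w ≡ false
oneZero⇒¬zeroFree (zero ∷ w)  _ = refl
oneZero⇒¬zeroFree (suc _ ∷ w) h = oneZero⇒¬zeroFree w h

map-suc-pred : ∀ w → T (zeroFree w) → map suc (map pred w) ≡ w
map-suc-pred []          _ = refl
map-suc-pred (suc x ∷ w) h = cong (suc x ∷_) (map-suc-pred w h)

any-map : ∀ (p : ℕ → Bool) (f : ℕ → ℕ) w → any p (map f w) ≡ any (p ∘ f) w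
any-map p f w = cong or (sym (map-∘ w))

any-zero : ∀ w → any (0 ≡ᵇ_) w ≡ not (zeroFree w)
any-zero []          = refl
any-zero (zero ∷ _)  = refl
any-zero (suc _ ∷ w) = any-zero w

any-positive : ∀ w → any (0 <ᵇ_) w ≡ not (allZero w)
any-positive []          = refl
any-positive (zero ∷ w)  = any-positive w
any-positive (suc _ ∷ _) = refl

any-dropZero : ∀ (p : ℕ → Bool) → p 0 ≡ false →
               ∀ w → T (oneZero w) → any (p ∘ suc) (dropZero w) ≡ any p w
any-dropZero p p0 (zero ∷ w)  h rewrite p0 =
  trans (sym (any-map p suc (map pred w))) (cong (any p) (map-suc-pred w h))
any-dropZero p p0 (suc y ∷ w) h = cong (p (suc y) ∨_) (any-dropZero p p0 w h)

any-map-suc-++-allZero : ∀ (p : ℕ → Bool) → p 0 ≡ false →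
                         ∀ u {v} → T (allZero v) → any p (map suc u ++ v) ≡ any (p ∘ suc) u
any-map-suc-++-allZero p p0 []      {[]}       _ = refl
any-map-suc-++-allZero p p0 []      {zero ∷ v} h rewrite p0 = any-map-suc-++-allZero p p0 [] {v} h
any-map-suc-++-allZero p p0 (x ∷ u) h = cong (p (suc x) ∨_) (any-map-suc-++-allZero p p0 u h)

allZero⇒¬bad : ∀ w → T (allZero w) → bad w ≡ false
allZero⇒¬bad []         _ = refl
allZero⇒¬bad (zero ∷ w) h rewrite any-positive w | to T-≡ h | allZero⇒¬bad w h =
  cong (_∨ false) (∧-zeroʳ _)

recursWithLarger-map-suc : ∀ x w → recursWithLarger (suc x) (map suc w) ≡ recursWithLarger x w
recursWithLarger-map-suc x w = cong₂ _∧_ (any-map (suc x ≡ᵇ_) suc w) (any-map (suc x <ᵇ_) suc w)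

bad-map-suc : ∀ w → bad (map suc w) ≡ bad w
bad-map-suc []      = refl
bad-map-suc (x ∷ w) = cong₂ _∨_ (recursWithLarger-map-suc x w) (bad-map-suc w)

-- A letter 0 occurring once is never part of a 112 or 121.
bad-dropZero : ∀ w → T (oneZero w) → bad (dropZero w) ≡ bad w
bad-dropZero (zero ∷ w) h rewrite any-zero w | to T-≡ h = begin
  bad (map pred w)              ≡⟨ bad-map-suc (map pred w) ⟨
  bad (map suc (map pred w))    ≡⟨ cong bad (map-suc-pred w h) ⟩
  bad w                         ∎
bad-dropZero (suc y ∷ w) h =
  cong₂ _∨_ (cong₂ _∧_ (any-dropZero (suc y ≡ᵇ_) refl w h) (any-dropZero (suc y <ᵇ_) refl w h))
            (bad-dropZero w h)

-- If 0 occurs after the first 0, the first 0 starts a pattern unless everything after it is 0.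
bad-firstZero : ∀ u w → zeroFree w ≡ false → bad (map suc u ++ 0 ∷ w) ≡ not (allZero w) ∨ bad u
bad-firstZero [] w zf with allZero w in az
... | true  rewrite any-zero w | zf | any-positive w | az = allZero⇒¬bad w (from T-≡ az)
... | false rewrite any-zero w | zf | any-positive w | az = refl
bad-firstZero (x ∷ u) w zf with allZero w in az
... | false rewrite bad-firstZero u w zf | az = ∨-zeroʳ _
... | true  rewrite bad-firstZero u w zf | az =
  cong (_∨ bad u) (cong₂ _∧_ (any-map-suc-++-allZero (suc x ≡ᵇ_) refl u (from T-≡ az))
                             (any-map-suc-++-allZero (suc x <ᵇ_) refl u (from T-≡ az)))

twoZeros-avoiding : ∀ u w → not (oneZero w) ∧ (not (zeroFree w) ∧ not (bad (map suc u ++ w)))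
                             ≡ zeroTail (λ v → not (bad (u ++ v))) w
twoZeros-avoiding u []          = refl
twoZeros-avoiding u (zero ∷ w) with zeroFree w in zf
... | true  = sym (∧-zeroʳ (allZero w))
... | false rewrite bad-firstZero u w zf | ++-identityʳ u with allZero w
...   | true  = refl
...   | false = refl
twoZeros-avoiding u (suc y ∷ w) = begin
  not (oneZero w) ∧ (not (zeroFree w) ∧ not (bad (map suc u ++ suc y ∷ w)))
    ≡⟨ cong (λ v → not (oneZero w) ∧ (not (zeroFree w) ∧ not (bad v))) shift ⟩
  not (oneZero w) ∧ (not (zeroFree w) ∧ not (bad (map suc (u ++ [ y ]) ++ w)))
    ≡⟨ twoZeros-avoiding (u ++ [ y ]) w ⟩
  zeroTail (λ v → not (bad ((u ++ [ y ]) ++ v))) w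
    ≡⟨ zeroTail-cong (λ v → cong (not ∘ bad) (++-assoc u [ y ] v)) w ⟩
  zeroTail (λ v → not (bad (u ++ y ∷ v))) w ∎
  where
  shift : map suc u ++ suc y ∷ w ≡ map suc (u ++ [ y ]) ++ w
  shift = trans (sym (++-assoc (map suc u) [ suc y ] w)) (cong (_++ w) (sym (map-++ suc u [ y ])))

module _ (k : ℕ) where

  countWords-zeroFree : ∀ n p → countWords (suc k) n (λ w → zeroFree w ∧ p w)
                                ≡ countWords k n (p ∘ map suc)
  countWords-zeroFree zero    p = refl
  countWords-zeroFree (suc n) p = begin
    countWords (suc k) (suc n) (λ w → zeroFree w ∧ p w)
      ≡⟨ countWords-suc (suc k) n (λ w → zeroFree w ∧ p w) ⟩
    countWords (suc k) n (λ _ → false)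
      + ∑[ b < k ] countWords (suc k) n (λ w → zeroFree w ∧ p (suc (toℕ b) ∷ w))
      ≡⟨ cong₂ _+_ (count-false (allWords (suc k) n))
                   (sum-cong-≗ {k} λ b → countWords-zeroFree n (λ w → p (suc (toℕ b) ∷ w))) ⟩
    ∑[ b < k ] countWords k n (λ w → p (suc (toℕ b) ∷ map suc w))
      ≡⟨ countWords-suc k n (p ∘ map suc) ⟨
    countWords k (suc n) (p ∘ map suc) ∎

  countWords-oneZero : ∀ n q → countWords (suc k) (suc n) (λ w → oneZero w ∧ q (dropZero w))
                               ≡ suc n * countWords k n q
  countWords-oneZero n q = begin
    countWords (suc k) (suc n) (λ w → oneZero w ∧ q (dropZero w))
      ≡⟨ countWords-suc (suc k) n (λ w → oneZero w ∧ q (dropZero w)) ⟩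
    countWords (suc k) n (λ w → zeroFree w ∧ q (map pred w))
      + ∑[ b < k ] countWords (suc k) n (λ w → oneZero w ∧ q (toℕ b ∷ dropZero w))
      ≡⟨ cong₂ _+_ zeroFirst (zeroLater n) ⟩
    countWords k n q + n * countWords k n q ∎
    where
    zeroFirst : countWords (suc k) n (λ w → zeroFree w ∧ q (map pred w)) ≡ countWords k n q
    zeroFirst = trans (countWords-zeroFree n (q ∘ map pred))
                      (countWords-cong k n λ w → cong q (trans (sym (map-∘ w)) (map-id w)))
    zeroLater : ∀ m → ∑[ b < k ] countWords (suc k) m (λ w → oneZero w ∧ q (toℕ b ∷ dropZero w))
                      ≡ m * countWords k m q
    zeroLater zero    = sum-replicate-zero k
    zeroLater (suc m) = begin
      ∑[ b < k ] countWords (suc k) (suc m) (λ w → oneZero w ∧ q (toℕ b ∷ dropZero w))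
        ≡⟨ sum-cong-≗ {k} (λ b → countWords-oneZero m (λ v → q (toℕ b ∷ v))) ⟩
      ∑[ b < k ] (suc m * countWords k m (λ v → q (toℕ b ∷ v)))
        ≡⟨ *-distribˡ-sum {k} (suc m) _ ⟨
      suc m * ∑[ b < k ] countWords k m (λ v → q (toℕ b ∷ v))
        ≡⟨ cong (suc m *_) (countWords-suc k m q) ⟨
      suc m * countWords k (suc m) q ∎

  countWords-allZero : ∀ n p → countWords (suc k) n (λ w → allZero w ∧ p w)
                               ≡ (if p (replicate n 0) then 1 else 0)
  countWords-allZero zero    p = refl
  countWords-allZero (suc n) p = begin
    countWords (suc k) (suc n) (λ w → allZero w ∧ p w)
      ≡⟨ countWords-suc (suc k) n (λ w → allZero w ∧ p w) ⟩
    countWords (suc k) n (λ w → allZero w ∧ p (0 ∷ w)) + ∑[ b < k ] countWords (suc k) n (λ _ → false)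
      ≡⟨ cong₂ _+_ (countWords-allZero n (λ w → p (0 ∷ w))) (∑-countWords-false k (suc k) n) ⟩
    (if p (replicate (suc n) 0) then 1 else 0) + 0
      ≡⟨ +-identityʳ _ ⟩
    (if p (replicate (suc n) 0) then 1 else 0) ∎

  countWords-zeroTail : ∀ n q → countWords (suc k) n (zeroTail q)
                                ≡ ∑[ i < n ∸ 1 ] countWords k (toℕ i) q
  countWords-zeroTail zero    q = refl
  countWords-zeroTail (suc n) q = begin
    countWords (suc k) (suc n) (zeroTail q)
      ≡⟨ countWords-suc (suc k) n (zeroTail q) ⟩
    zeroRun n + ∑[ b < k ] countWords (suc k) n (zeroTail (λ v → q (toℕ b ∷ v)))
      ≡⟨ cong (zeroRun n +_) (sum-cong-≗ {k} λ b → countWords-zeroTail n (λ v → q (toℕ b ∷ v))) ⟩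
    zeroRun n + ∑[ b < k ] ∑[ i < n ∸ 1 ] countWords k (toℕ i) (λ v → q (toℕ b ∷ v))
      ≡⟨ cong (zeroRun n +_) (∑-comm {k} {n ∸ 1} _) ⟩
    zeroRun n + ∑[ i < n ∸ 1 ] ∑[ b < k ] countWords k (toℕ i) (λ v → q (toℕ b ∷ v))
      ≡⟨ cong (zeroRun n +_) (sum-cong-≗ {n ∸ 1} λ i → countWords-suc k (toℕ i) q) ⟨
    zeroRun n + ∑[ i < n ∸ 1 ] countWords k (suc (toℕ i)) q
      ≡⟨ zeroRun-+ n ⟩
    ∑[ i < n ] countWords k (toℕ i) q ∎
    where
    zeroRun : ℕ → ℕ
    zeroRun m = countWords (suc k) m (λ w → allZero w ∧ (not (zeroFree w) ∧ q []))
    zeroRun-+ : ∀ m → zeroRun m + ∑[ i < m ∸ 1 ] countWords k (suc (toℕ i)) q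
                      ≡ ∑[ i < m ] countWords k (toℕ i) q
    zeroRun-+ zero    = refl
    zeroRun-+ (suc m) = cong (_+ ∑[ i < m ] countWords k (suc (toℕ i)) q)
                             (countWords-allZero (suc m) (λ w → not (zeroFree w) ∧ q []))

oneZero-avoiding : ∀ w → oneZero w ∧ (not (zeroFree w) ∧ not (bad w))
                         ≡ oneZero w ∧ not (bad (dropZero w))
oneZero-avoiding w with oneZero w in e
... | false = refl
... | true  rewrite oneZero⇒¬zeroFree w (from T-≡ e) | bad-dropZero w (from T-≡ e) = refl

avoiders-suc : ∀ k n → avoiders (suc k) (suc n)
                       ≡ avoiders k (suc n) + (suc n * avoiders k n + ∑[ i < n ] avoiders k (toℕ i))
avoiders-suc k n = begin
  avoiders (suc k) (suc n)
    ≡⟨ countWords-split (suc k) (suc n) zeroFree (not ∘ bad) ⟩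
  #zeroFree + countWords (suc k) (suc n) avoidingWithZero
    ≡⟨ cong (#zeroFree +_) (countWords-split (suc k) (suc n) oneZero avoidingWithZero) ⟩
  #zeroFree + (#oneZero + #twoZeros)
    ≡⟨ cong₂ _+_ #zeroFree≡ (cong₂ _+_ #oneZero≡ #twoZeros≡) ⟩
  avoiders k (suc n) + (suc n * avoiders k n + ∑[ i < n ] avoiders k (toℕ i)) ∎
  where
  avoidingWithZero : List ℕ → Bool
  avoidingWithZero w = not (zeroFree w) ∧ not (bad w)
  #zeroFree #oneZero #twoZeros : ℕ
  #zeroFree = countWords (suc k) (suc n) (λ w → zeroFree w ∧ not (bad w))
  #oneZero  = countWords (suc k) (suc n) (λ w → oneZero w ∧ avoidingWithZero w)
  #twoZeros = countWords (suc k) (suc n) (λ w → not (oneZero w) ∧ avoidingWithZero w)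
  #zeroFree≡ : #zeroFree ≡ avoiders k (suc n)
  #zeroFree≡ = trans (countWords-zeroFree k (suc n) (not ∘ bad))
                     (countWords-cong k (suc n) (cong not ∘ bad-map-suc))
  #oneZero≡ : #oneZero ≡ suc n * avoiders k n
  #oneZero≡ = trans (countWords-cong (suc k) (suc n) oneZero-avoiding)
                    (countWords-oneZero k n (not ∘ bad))
  #twoZeros≡ : #twoZeros ≡ ∑[ i < n ] avoiders k (toℕ i)
  #twoZeros≡ = trans (countWords-cong (suc k) (suc n) (twoZeros-avoiding []))
                     (countWords-zeroTail k (suc n) (not ∘ bad))

-- Generating functions

∑-init-last : ∀ (g : ℕ → ℕ) n → ∑[ i < suc n ] g (toℕ i) ≡ ∑[ i < n ] g (toℕ i) + g n
∑-init-last g n = trans (sum-init-last {n} (g ∘ toℕ))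
                        (cong₂ _+_ (sum-cong-≗ {n} (cong g ∘ toℕ-inject₁)) (cong g (toℕ-fromℕ n)))

convSum-geom : ∀ F i d → convSum geom F (i + d) i ≡ ∑[ j < suc i ] F (d + toℕ j)
convSum-geom F zero    d = cong (λ m → F m + 0) (sym (+-identityʳ d))
convSum-geom F (suc i) d = cong₂ _+_ first rest
  where
  first : 1 * F (suc i + d ∸ suc i) ≡ F (d + 0)
  first = trans (+-identityʳ _) (cong F (trans (m+n∸m≡n i d) (sym (+-identityʳ d))))
  rest : convSum geom F (suc i + d) i ≡ ∑[ j < suc i ] F (d + suc (toℕ j))
  rest = begin
    convSum geom F (suc i + d) i      ≡⟨ cong (λ m → convSum geom F m i) (+-suc i d) ⟨
    convSum geom F (i + suc d) i      ≡⟨ convSum-geom F i (suc d) ⟩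
    ∑[ j < suc i ] F (suc d + toℕ j)  ≡⟨ sum-cong-≗ {suc i} (λ j → cong F (+-suc d (toℕ j))) ⟨
    ∑[ j < suc i ] F (d + suc (toℕ j)) ∎

geom-⊗ : ∀ F n → (geom ⊗ F) n ≡ ∑[ i < suc n ] F (toℕ i)
geom-⊗ F n = trans (cong (λ m → convSum geom F m n) (sym (+-identityʳ n))) (convSum-geom F n 0)

convSum-x² : ∀ F m i → convSum x² F m (suc (suc i)) ≡ F (m ∸ 2)
convSum-x² F m zero    = trans (+-identityʳ _) (+-identityʳ _)
convSum-x² F m (suc i) = convSum-x² F m i

x²-⊗-deriv : ∀ F n → (x² ⊗ deriv F) (suc n) ≡ n * F n
x²-⊗-deriv F zero    = refl
x²-⊗-deriv F (suc n) = convSum-x² (deriv F) (suc (suc n)) n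

recurrence⇒gf : ∀ (F G : FPS) → G 0 ≡ F 0 →
                (∀ n → G (suc n) ≡ F (suc n) + (suc n * F n + ∑[ i < n ] F (toℕ i))) →
                G ≈ ((geom ⊗ F) ⊕ (x² ⊗ deriv F))
recurrence⇒gf F G G₀ Gₛ zero    = trans G₀ (sym (trans (+-identityʳ _) (+-identityʳ _)))
recurrence⇒gf F G G₀ Gₛ (suc n) = begin
  G (suc n)
    ≡⟨ Gₛ n ⟩
  F (suc n) + (suc n * F n + S)
    ≡⟨ solve 4 (λ a b c s → a :+ ((con 1 :+ c) :* b :+ s) := s :+ b :+ a :+ c :* b) refl (F (suc n)) (F n) n S ⟩
  S + F n + F (suc n) + n * F n
    ≡⟨ cong₂ _+_ prefix (x²-⊗-deriv F n) ⟨
  (geom ⊗ F) (suc n) + (x² ⊗ deriv F) (suc n) ∎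
  where
  open +-*-Solver
  S = ∑[ i < n ] F (toℕ i)
  prefix : (geom ⊗ F) (suc n) ≡ S + F n + F (suc n)
  prefix = trans (geom-⊗ F (suc n))
                 (trans (∑-init-last F (suc n)) (cong (_+ F (suc n)) (∑-init-last F n)))

H-suc : ∀ k n → H (suc k) (suc n) ≡ H k (suc n) + (suc n * H k n + ∑[ i < n ] H k (toℕ i))
H-suc k n = begin
  H (suc k) (suc n)
    ≡⟨ H≡avoiders (suc k) (suc n) ⟩
  avoiders (suc k) (suc n)
    ≡⟨ avoiders-suc k n ⟩
  avoiders k (suc n) + (suc n * avoiders k n + ∑[ i < n ] avoiders k (toℕ i))
    ≡⟨ cong₂ _+_ (H≡avoiders k (suc n))
                 (cong₂ _+_ (cong (suc n *_) (H≡avoiders k n)) (sum-cong-≗ {n} (H≡avoiders k ∘ toℕ))) ⟨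
  H k (suc n) + (suc n * H k n + ∑[ i < n ] H k (toℕ i)) ∎

theorem6 : (H 0 ≈ one)
    × ((k : ℕ) → H (suc k) ≈ ((geom ⊗ H k) ⊕ (x² ⊗ deriv (H k))))
theorem6 = H-zero , λ k → recurrence⇒gf (H k) (H (suc k)) refl (H-suc k)
  where
  H-zero : H 0 ≈ one
  H-zero zero    = refl
  H-zero (suc n) = refl
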